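{- Let $G$ be a forest on $n$ vertices and let $G'$ be the $s$-forest obtained from $G$ by the partitioning construction with threshold $s$. For any $R>s$, the total number of vertices lying in $R$-bad $s$-rooted trees of $G'$ is at most $4sn/R$.
   Context: Partitioning construction with threshold $s$ applied to a forest $G$: high-degree vertices $V_h$ are those with $\deg_G(v)>s$, low-degree $V_l$ the rest; a component of $G[V_l]$ is large if it has more than $s$ vertices, small otherwise. $G'$ is obtained from $G$ by removing all edges inside $V_h$, removing all edges between $V_h$ and any small component of $G[V_l]$ adjacent to at least two vertices of $V_h$, and removing all edges between $V_h$ and large components of $G[V_l]$. An $s$-rooted tree is a tree $T$ containing a unique vertex $\mathrm{root}(T)$ of degree at least $s+1$ such that every component of $T-\mathrm{root}(T)$ has at most $s$ vertices. For $R>s$, a vertex $v$ is $R$-bad if $R\cdot\max(\deg_{G'}(v),1)\le\deg_G(v)$, and $R$-good otherwise; an $s$-rooted tree of $G'$ is $R$-bad if its root is $R$-bad.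
   Formalization: The parameter R, which must exceed s, takes only rational values. -}

module Defs where

open import Level using (0ℓ)
open import Data.Nat using (ℕ; zero; suc; _+_; _*_; _≤_; _<_; _⊔_)
open import Data.Bool using (Bool; true; false; if_then_else_)
open import Data.Fin using (Fin)
open import Data.List using (List; []; _∷_; _++_; [_]; length; map; allFin)
open import Data.Nat.ListAction using (sum)
open import Data.List.Relation.Unary.All using (All)
open import Data.List.Relation.Unary.Linked using (Linked)
open import Data.List.Relation.Unary.Unique.Propositional using (Unique)
open import Data.List.Membership.Propositional using (_∈_)
open import Data.Product using (Σ; ∃; ∃-syntax; _×_; _,_)
open import Data.Sum using (_⊎_)
open import Relation.Nullary using (¬_)
open import Relation.Binary.PropositionalEquality using (_≡_; _≢_)
open import Relation.Binary.Construct.Closure.ReflexiveTransitive using (Star)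
open import Function.Bundles using (_⇔_)
open import Data.Integer using (+_)
open import Data.Rational as ℚ using (ℚ; _/_)

toℚ : ℕ → ℚ
toℚ k = (+ k) / 1

module _ {n : ℕ} where

  HasSize : (Fin n → Set) → ℕ → Set
  HasSize P k = Σ (List (Fin n)) λ L → Unique L × length L ≡ k × (∀ u → (u ∈ L) ⇔ P u)

  AtMost : (Fin n → Set) → ℕ → Set
  AtMost P k = ∀ (L : List (Fin n)) → Unique L → All P L → length L ≤ k

  MoreThan : (Fin n → Set) → ℕ → Set
  MoreThan P k = Σ (List (Fin n)) λ L → Unique L × All P L × k < length L

  Induced : (Fin n → Fin n → Set) → (Fin n → Set) → Fin n → Fin n → Set
  Induced E P u v = P u × P v × E u v

  Conn : (Fin n → Fin n → Set) → Fin n → Fin n → Set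
  Conn E = Star E

  Degree : (Fin n → Fin n → Set) → Fin n → ℕ → Set
  Degree E v d = HasSize (E v) d

BGraph : ℕ → Set
BGraph n = Fin n → Fin n → Bool

module _ {n : ℕ} (G : BGraph n) where

  Edge : Fin n → Fin n → Set
  Edge u v = G u v ≡ true

  deg : Fin n → ℕ
  deg v = sum (map (λ u → if G v u then 1 else 0) (allFin n))

  HasCycle : Set
  HasCycle = Σ (Fin n) λ x → Σ (List (Fin n)) λ ys →
    2 ≤ length ys × Unique (x ∷ ys) × Linked Edge (x ∷ ys ++ [ x ])

  record IsForest : Set where
    field
      symmetric   : ∀ u v → G u v ≡ G v u
      irreflexive : ∀ v → G v v ≡ false
      acyclic     : ¬ HasCycle

module Partition {n : ℕ} (G : BGraph n) (s : ℕ) where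

  High : Fin n → Set
  High v = s < deg G v

  Low : Fin n → Set
  Low v = deg G v ≤ s

  InComp : Fin n → Fin n → Set
  InComp l x = Conn (Induced (Edge G) Low) l x

  SmallComp : Fin n → Set
  SmallComp l = AtMost (InComp l) s

  LargeComp : Fin n → Set
  LargeComp l = MoreThan (InComp l) s

  TwoHighNbrs : Fin n → Set
  TwoHighNbrs l = Σ (Fin n) λ h₁ → Σ (Fin n) λ h₂ → h₁ ≢ h₂ × High h₁ × High h₂ ×
    (∃[ x ] InComp l x × Edge G x h₁) × (∃[ y ] InComp l y × Edge G y h₂)

  -- an edge between V_h and the component of l survives iff that
  -- component is small and not adjacent to two vertices of V_h
  KeptAttach : Fin n → Set
  KeptAttach l = SmallComp l × ¬ TwoHighNbrs l

  Keep : Fin n → Fin n → Set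
  Keep u v = (Low u × Low v)
           ⊎ (High u × Low v × KeptAttach v)
           ⊎ (Low u × High v × KeptAttach u)

  Edge' : Fin n → Fin n → Set
  Edge' u v = Edge G u v × Keep u v

  Bad : ℚ → Fin n → Set
  Bad R v = Σ ℕ λ d → Degree Edge' v d × (R ℚ.* toℚ (d ⊔ 1)) ℚ.≤ toℚ (deg G v)

  -- r is the root of an s-rooted tree of G' (namely its component in G'):
  -- r is the unique vertex of degree ≥ s+1 in its component, and every
  -- component of (that tree) − r has at most s vertices.
  IsRoot : Fin n → Set
  IsRoot r =
      (Σ ℕ λ d → Degree Edge' r d × s < d)
    × (∀ u → Conn Edge' r u → u ≢ r → ∀ d → Degree Edge' u d → d ≤ s)
    × (∀ u → Conn Edge' r u → u ≢ r →
         AtMost (Conn (Induced Edge' (λ x → x ≢ r)) u) s)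

  InBadRootedTree : ℚ → Fin n → Set
  InBadRootedTree R v = Σ (Fin n) λ r → IsRoot r × Bad R r × Conn Edge' r v

-- An s-rooted tree with root r of G'-degree d consists of r and the d branches of the tree
-- minus r, each with at most s vertices, so it has at most 1 + d s ≤ 2 s d vertices; if r is
-- R-bad then R d ≤ deg_G(r), so R times its size is at most 2 s deg_G(r). Grouping the
-- vertices by the root of their tree and summing over roots leaves 2 s times the degree sum
-- of the forest G, which is at most 2n: deleting a vertex of degree at most one removes at most two
-- edge ends, and a nonempty vertex set in which every vertex has two neighbours inside
-- the set would contain a cycle.
module Submission where

open import Defs
open import Data.Nat using (ℕ; zero; suc; _+_; _*_; _≤_; _<_; z≤n; s≤s; s≤s⁻¹; _≤?_)
open import Data.Nat.Properties hiding (_≟_)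
open import Data.Nat.ListAction using (sum)
open import Data.Bool as Bool using (Bool; true; false; if_then_else_; _∧_; not)
open import Data.List using (List; []; _∷_; _++_; [_]; length; map; allFin)
open import Data.List.Properties using (map-cong; length-tabulate)
open import Data.List.Relation.Unary.All as All using (All; []; _∷_)
import Data.List.Relation.Unary.All.Properties as All
open import Data.List.Relation.Unary.Any using (Any; here; there; any?; satisfied)
open import Data.List.Relation.Unary.AllPairs using ([]; _∷_)
open import Data.List.Relation.Unary.Linked using (Linked; []; [-]; _∷_)
open import Data.List.Relation.Unary.Unique.Propositional using (Unique)
open import Data.List.Relation.Unary.Unique.Propositional.Properties using (allFin⁺)
open import Data.List.Membership.Propositional using (_∈_; _∉_; lose)
open import Data.List.Membership.Propositional.Properties using (∈-allFin; ∈-∃++; ∈-++⁺ʳ; ∈-length)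
open import Data.List.Relation.Binary.Subset.Propositional using (_⊆_)
open import Data.List.Relation.Binary.Subset.Propositional.Properties using (⊆-trans; xs⊆x∷xs; ∷⁺ʳ)
open import Data.Fin using (Fin)
open import Data.Fin.Properties using (_≟_)
open import Data.Product using (∃-syntax; ∃₂; _×_; _,_; proj₁; proj₂)
open import Data.Sum using (_⊎_; inj₁; inj₂)
import Data.Integer as ℤ
open import Data.Sign using (Sign)
import Data.Integer.Properties as ℤ
open import Data.Rational as ℚ using (ℚ; mkℚ)
import Data.Rational.Properties as ℚₚ
import Data.Nat.Coprimality as Coprime
open import Data.Nat.Tactic.RingSolver using (solve-∀)
open import Algebra.Properties.CommutativeSemigroup +-commutativeSemigroup using (interchange)
open import Function using (_∘_)
open import Function.Bundles using (Equivalence)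
open import Relation.Nullary using (¬_; yes; no; does; contradiction)
open import Relation.Nullary.Decidable using (_×-dec_)
open import Relation.Binary.Definitions using (DecidableEquality)
open import Relation.Binary.PropositionalEquality
  using (_≡_; _≢_; refl; sym; trans; cong; cong₂; subst; module ≡-Reasoning)
open import Relation.Binary.Construct.Closure.ReflexiveTransitive using (ε; _◅_)

module _ {A : Set} where

  ∈-remove : ∀ {x : A} {ys} → x ∈ ys →
    ∃[ zs ] length ys ≡ suc (length zs) × (∀ {y} → y ∈ ys → y ≢ x → y ∈ zs)
  ∈-remove {ys = _ ∷ ys} (here refl) =
    ys , refl , λ { (here refl) y≢x → contradiction refl y≢x ; (there y∈ys) _ → y∈ys }
  ∈-remove {ys = y ∷ _} (there x∈ys) with ∈-remove x∈ys
  ... | zs , len , ⊆zs =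
    y ∷ zs , cong suc len , λ { (here refl) _ → here refl ; (there w∈) w≢x → there (⊆zs w∈ w≢x) }

  Unique-length-≤ : ∀ {xs ys : List A} → Unique xs → xs ⊆ ys → length xs ≤ length ys
  Unique-length-≤ {[]}     _             _     = z≤n
  Unique-length-≤ {x ∷ xs} (x∉xs ∷ uniq) xs⊆ys with ∈-remove (xs⊆ys (here refl))
  ... | zs , len , ⊆zs rewrite len =
    s≤s (Unique-length-≤ uniq λ y∈xs → ⊆zs (xs⊆ys (there y∈xs)) λ { refl → All.lookup x∉xs y∈xs refl })

  Unique-prefix-∷ʳ : ∀ xs {y : A} {ys} → Unique (xs ++ y ∷ ys) → Unique (xs ++ [ y ])
  Unique-prefix-∷ʳ []       _               = [] ∷ []
  Unique-prefix-∷ʳ (x ∷ xs) (x∉rest ∷ uniq) =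
    All.++⁺ (All.++⁻ˡ xs x∉rest) (All.head (All.++⁻ʳ xs x∉rest) ∷ []) ∷ Unique-prefix-∷ʳ xs uniq

  Linked-prefix-∷ʳ : ∀ {R : A → A → Set} xs {y ys z} →
    Linked R (xs ++ y ∷ ys) → R y z → Linked R ((xs ++ [ y ]) ++ [ z ])
  Linked-prefix-∷ʳ []           _            yRz = yRz ∷ [-]
  Linked-prefix-∷ʳ (x ∷ [])     (xRy ∷ rest) yRz = xRy ∷ Linked-prefix-∷ʳ [] rest yRz
  Linked-prefix-∷ʳ (x ∷ w ∷ xs) (xRw ∷ rest) yRz = xRw ∷ Linked-prefix-∷ʳ (w ∷ xs) rest yRz

  module _ {P Q : A → Set} where

    split-⊎ : ∀ {xs} → Unique xs → All (λ x → P x ⊎ Q x) xs →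
      ∃₂ λ ys zs → (Unique ys × All P ys × ys ⊆ xs) × (Unique zs × All Q zs × zs ⊆ xs) ×
                   length xs ≡ length ys + length zs
    split-⊎ {[]} [] [] = [] , [] , ([] , [] , λ ()) , ([] , [] , λ ()) , refl
    split-⊎ {x ∷ xs} (x∉xs ∷ uniq) (px⊎qx ∷ pqs) with split-⊎ uniq pqs
    ... | ys , zs , (uys , pys , ys⊆) , (uzs , qzs , zs⊆) , len with px⊎qx
    ...   | inj₁ px = x ∷ ys , zs , (All.anti-mono ys⊆ x∉xs ∷ uys , px ∷ pys , ∷⁺ʳ x ys⊆) ,
                      (uzs , qzs , ⊆-trans zs⊆ (xs⊆x∷xs xs x)) , cong suc len
    ...   | inj₂ qx = ys , x ∷ zs , (uys , pys , ⊆-trans ys⊆ (xs⊆x∷xs xs x)) ,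
                      (All.anti-mono zs⊆ x∉xs ∷ uzs , qx ∷ qzs , ∷⁺ʳ x zs⊆) ,
                      trans (cong suc len) (sym (+-suc (length ys) (length zs)))

module _ {n : ℕ} where

  Unique-length-≤-n : ∀ {xs : List (Fin n)} → Unique xs → length xs ≤ n
  Unique-length-≤-n {xs} uniq = subst (length xs ≤_) (length-tabulate (λ i → i))
    (Unique-length-≤ {ys = allFin n} uniq λ {x} _ → ∈-allFin x)

  AtMost-⊆ : ∀ {P Q : Fin n → Set} {k} → (∀ {x} → P x → Q x) → AtMost Q k → AtMost P k
  AtMost-⊆ P⊆Q atMost L uniq ps = atMost L uniq (All.map P⊆Q ps)

  AtMost-≡ : ∀ (r : Fin n) → AtMost (_≡ r) 1
  AtMost-≡ r L uniq ≡r = Unique-length-≤ {ys = [ r ]} uniq λ x∈L → here (All.lookup ≡r x∈L)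

  AtMost-⊎ : ∀ {P Q : Fin n → Set} {a b} → AtMost P a → AtMost Q b →
    AtMost (λ x → P x ⊎ Q x) (a + b)
  AtMost-⊎ atMostP atMostQ L uniq pqs with split-⊎ uniq pqs
  ... | ys , zs , (uys , pys , _) , (uzs , qzs , _) , len rewrite len =
    +-mono-≤ (atMostP ys uys pys) (atMostQ zs uzs qzs)

  AtMost-Any : ∀ {P : Fin n → Fin n → Set} {k} (N : List (Fin n)) →
    (∀ {w} → w ∈ N → AtMost (P w) k) → AtMost (λ x → Any (λ w → P w x) N) (length N * k)
  AtMost-Any []      _      []      _    []         = z≤n
  AtMost-Any []      _      (_ ∷ _) _    (() ∷ _)
  AtMost-Any {P} (w ∷ N) atMost L uniq anys =
    AtMost-⊎ (atMost (here refl)) (AtMost-Any N (atMost ∘ there)) L uniq (All.map headOrTail anys)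
    where headOrTail : ∀ {x} → Any (λ v → P v x) (w ∷ N) → P w x ⊎ Any (λ v → P v x) N
          headOrTail (here p)  = inj₁ p
          headOrTail (there p) = inj₂ p

  HasSize-unique : ∀ {P : Fin n → Set} {a b} → HasSize P a → HasSize P b → a ≡ b
  HasSize-unique (L , uL , refl , L⇔) (M , uM , refl , M⇔) =
    ≤-antisym (Unique-length-≤ uL λ {x} → Equivalence.from (M⇔ x) ∘ Equivalence.to (L⇔ x))
              (Unique-length-≤ uM λ {x} → Equivalence.from (L⇔ x) ∘ Equivalence.to (M⇔ x))

𝟙 : Bool → ℕ
𝟙 b = if b then 1 else 0

module _ {A : Set} where

  sum-map-+ : ∀ (f g : A → ℕ) xs → sum (map (λ x → f x + g x) xs) ≡ sum (map f xs) + sum (map g xs)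
  sum-map-+ f g []       = refl
  sum-map-+ f g (x ∷ xs) rewrite sum-map-+ f g xs = interchange (f x) (g x) _ _

  sum-map-+₃ : ∀ (f g h : A → ℕ) xs →
    sum (map (λ x → f x + g x + h x) xs) ≡ sum (map f xs) + sum (map g xs) + sum (map h xs)
  sum-map-+₃ f g h xs =
    trans (sum-map-+ _ h xs) (cong (_+ sum (map h xs)) (sum-map-+ f g xs))

  sum-map-mono : ∀ {f g : A → ℕ} xs → (∀ x → f x ≤ g x) → sum (map f xs) ≤ sum (map g xs)
  sum-map-mono []       _   = z≤n
  sum-map-mono (x ∷ xs) f≤g = +-mono-≤ (f≤g x) (sum-map-mono xs f≤g)

  sum-map-cong : ∀ {f g : A → ℕ} xs → (∀ x → f x ≡ g x) → sum (map f xs) ≡ sum (map g xs)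
  sum-map-cong xs f≡g = cong sum (map-cong f≡g xs)

  sum-map-≡0 : ∀ {f : A → ℕ} xs → (∀ x → f x ≡ 0) → sum (map f xs) ≡ 0
  sum-map-≡0 []       _    = refl
  sum-map-≡0 (x ∷ xs) f≡0 rewrite f≡0 x = sum-map-≡0 xs f≡0

  sum-map-*ˡ : ∀ c (f : A → ℕ) xs → sum (map (λ x → c * f x) xs) ≡ c * sum (map f xs)
  sum-map-*ˡ c f []       = sym (*-zeroʳ c)
  sum-map-*ˡ c f (x ∷ xs) rewrite sum-map-*ˡ c f xs = sym (*-distribˡ-+ c (f x) _)

  sum-map-const-1 : ∀ (xs : List A) → sum (map (λ _ → 1) xs) ≡ length xs
  sum-map-const-1 []       = refl
  sum-map-const-1 (x ∷ xs) = cong suc (sum-map-const-1 xs)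

  module _ (_≟ᴬ_ : DecidableEquality A) (v : A) (c : ℕ) where

    sum-map-indicator-∉ : ∀ {xs} → v ∉ xs → sum (map (λ u → if does (u ≟ᴬ v) then c else 0) xs) ≡ 0
    sum-map-indicator-∉ {[]}     _   = refl
    sum-map-indicator-∉ {x ∷ xs} v∉ with x ≟ᴬ v
    ... | yes refl = contradiction (here refl) v∉
    ... | no _     = sum-map-indicator-∉ (v∉ ∘ there)

    sum-map-indicator : ∀ {xs} → Unique xs → v ∈ xs →
      sum (map (λ u → if does (u ≟ᴬ v) then c else 0) xs) ≡ c
    sum-map-indicator {x ∷ xs} (x∉xs ∷ uniq) v∈ with x ≟ᴬ v | v∈
    ... | yes refl | _ =
      trans (cong (c +_) (sum-map-indicator-∉ λ x∈xs → All.lookup x∉xs x∈xs refl)) (+-identityʳ c)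
    ... | no x≢v | here v≡x   = contradiction (sym v≡x) x≢v
    ... | no _   | there v∈xs = sum-map-indicator uniq v∈xs

∑ : ∀ {n} → (Fin n → ℕ) → ℕ
∑ {n} f = sum (map f (allFin n))

∑-indicator : ∀ {n} (v : Fin n) c → ∑ (λ u → if does (u ≟ v) then c else 0) ≡ c
∑-indicator {n} v c = sum-map-indicator _≟_ v c (allFin⁺ n) (∈-allFin v)

∑-const-1 : ∀ n → ∑ {n} (λ _ → 1) ≡ n
∑-const-1 n = trans (sum-map-const-1 (allFin n)) (length-tabulate (λ i → i))

module _ {A : Set} {m : ℕ} {P : Fin m → A → Set} where

  fibre : Fin m → (xs : List A) → All (λ x → ∃[ i ] P i x) xs → List A
  fibre i []       []               = []
  fibre i (x ∷ xs) ((j , _) ∷ tags) = if does (i ≟ j) then x ∷ fibre i xs tags else fibre i xs tags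

  fibre-⊆ : ∀ i xs tags → fibre i xs tags ⊆ xs
  fibre-⊆ i (x ∷ xs) ((j , _) ∷ tags) y∈ with i ≟ j | y∈
  ... | yes _ | here refl = here refl
  ... | yes _ | there y∈  = there (fibre-⊆ i xs tags y∈)
  ... | no _  | y∈        = there (fibre-⊆ i xs tags y∈)

  fibre-unique : ∀ i {xs} tags → Unique xs → Unique (fibre i xs tags)
  fibre-unique i {[]}     []               []            = []
  fibre-unique i {x ∷ xs} ((j , _) ∷ tags) (x∉xs ∷ uniq) with i ≟ j
  ... | yes _ = All.anti-mono (fibre-⊆ i xs tags) x∉xs ∷ fibre-unique i tags uniq
  ... | no _  = fibre-unique i tags uniq

  fibre-all : ∀ i xs tags → All (P i) (fibre i xs tags)
  fibre-all i []       []                = []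
  fibre-all i (x ∷ xs) ((j , pj) ∷ tags) with i ≟ j
  ... | yes refl = pj ∷ fibre-all i xs tags
  ... | no _     = fibre-all i xs tags

  ∑-length-fibre : ∀ xs tags → ∑ (λ i → length (fibre i xs tags)) ≡ length xs
  ∑-length-fibre []       []               = sum-map-≡0 (allFin m) λ _ → refl
  ∑-length-fibre (x ∷ xs) ((j , pj) ∷ tags) = begin
    ∑ (λ i → length (fibre i (x ∷ xs) ((j , pj) ∷ tags)))
      ≡⟨ sum-map-cong (allFin m) split ⟩
    ∑ (λ i → (if does (i ≟ j) then 1 else 0) + length (fibre i xs tags))
      ≡⟨ sum-map-+ (λ i → if does (i ≟ j) then 1 else 0) (λ i → length (fibre i xs tags)) (allFin m) ⟩
    ∑ (λ i → if does (i ≟ j) then 1 else 0) + ∑ (λ i → length (fibre i xs tags))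
      ≡⟨ cong₂ _+_ (∑-indicator j 1) (∑-length-fibre xs tags) ⟩
    suc (length xs) ∎
    where
    open ≡-Reasoning
    split : ∀ i → length (fibre i (x ∷ xs) ((j , pj) ∷ tags))
                ≡ (if does (i ≟ j) then 1 else 0) + length (fibre i xs tags)
    split i with i ≟ j
    ... | yes _ = refl
    ... | no _  = refl

module _ {A : Set} (_≟ᴬ_ : DecidableEquality A) (f : A → Bool) where

  count-witness : ∀ xs → 1 ≤ sum (map (𝟙 ∘ f) xs) → ∃[ z ] z ∈ xs × f z ≡ true
  count-witness (x ∷ xs) pos with f x in fx
  ... | true  = x , here refl , fx
  ... | false with count-witness xs pos
  ...   | z , z∈xs , fz = z , there z∈xs , fz

  count-witness-≢ : ∀ {xs} → Unique xs → 2 ≤ sum (map (𝟙 ∘ f) xs) → ∀ y → ∃[ z ] z ≢ y × f z ≡ true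
  count-witness-≢ {x ∷ xs} (x∉xs ∷ uniq) two y with f x in fx | x ≟ᴬ y
  ... | true  | no x≢y = x , x≢y , fx
  ... | true  | yes refl with count-witness xs (s≤s⁻¹ two)
  ...   | z , z∈xs , fz = z , (λ { refl → All.lookup x∉xs z∈xs refl }) , fz
  count-witness-≢ (_ ∷ uniq) two y | false | _ = count-witness-≢ uniq two y

∧≡true : ∀ {a b} → a ∧ b ≡ true → a ≡ true × b ≡ true
∧≡true {true} {true} _ = refl , refl

𝟙-∧-≤ʳ : ∀ a b → 𝟙 (a ∧ b) ≤ 𝟙 b
𝟙-∧-≤ʳ true  b = ≤-refl
𝟙-∧-≤ʳ false b = z≤n

𝟙-∧-skip : ∀ a b c → 𝟙 (a ∧ b ∧ c) ≤ 𝟙 (a ∧ c)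
𝟙-∧-skip true  b c = 𝟙-∧-≤ʳ b c
𝟙-∧-skip false b c = z≤n

module ForestDegrees {n : ℕ} (G : BGraph n) (forest : IsForest G) where
  open IsForest forest
  open import Data.List.Membership.DecPropositional (_≟_ {n = n}) using (_∈?_)

  edge-sym : ∀ {u v} → Edge G u v → Edge G v u
  edge-sym {u} {v} e = trans (symmetric v u) e

  edge-irrefl : ∀ {v} → ¬ Edge G v v
  edge-irrefl {v} e with trans (sym e) (irreflexive v)
  ... | ()

  degIn : (Fin n → Bool) → Fin n → ℕ
  degIn A v = ∑ λ u → 𝟙 (A u ∧ G v u)

  size : (Fin n → Bool) → ℕ
  size A = ∑ λ v → 𝟙 (A v)

  edgeEnds : (Fin n → Bool) → ℕ
  edgeEnds A = ∑ λ w → ∑ λ u → 𝟙 (A w ∧ A u ∧ G w u)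

  _∖_ : (Fin n → Bool) → Fin n → Fin n → Bool
  (A ∖ v) u = not (does (u ≟ v)) ∧ A u

  other-neighbour : ∀ A v → 2 ≤ degIn A v → ∀ y → ∃[ z ] A z ≡ true × Edge G v z × z ≢ y
  other-neighbour A v two y with count-witness-≢ _≟_ (λ u → A u ∧ G v u) (allFin⁺ n) two y
  ... | z , z≢y , Az∧Gvz = z , proj₁ (∧≡true Az∧Gvz) , proj₂ (∧≡true Az∧Gvz) , z≢y

  module _ (A : Fin n → Bool) (minDeg2 : ∀ v → A v ≡ true → 2 ≤ degIn A v) where

    -- The path is stored newest vertex first; a neighbour of h₀ other than h₁ either extends
    -- it or closes a cycle, and the fuel runs out only if the path outgrows the n vertices.
    extend-path : ∀ fuel h₀ h₁ p → Unique (h₀ ∷ h₁ ∷ p) → Linked (Edge G) (h₀ ∷ h₁ ∷ p) →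
      A h₀ ≡ true → n < fuel + length (h₀ ∷ h₁ ∷ p) → HasCycle G
    extend-path zero h₀ h₁ p uniq _ _ n<len = contradiction (Unique-length-≤-n uniq) (<⇒≱ n<len)
    extend-path (suc fuel) h₀ h₁ p uniq linked Ah₀ n<len
      with other-neighbour A h₀ (minDeg2 h₀ Ah₀) h₁
    ... | z , Az , h₀z , z≢h₁ with z ∈? (h₀ ∷ h₁ ∷ p)
    ...   | no z∉ = extend-path fuel z h₀ (h₁ ∷ p)
                      (All.tabulate (λ w∈ z≡w → z∉ (subst (_∈ _) (sym z≡w) w∈)) ∷ uniq)
                      (edge-sym h₀z ∷ linked) Az (subst (n <_) (sym (+-suc fuel _)) n<len)
    ...   | yes (here refl)         = contradiction h₀z edge-irrefl
    ...   | yes (there (here refl)) = contradiction refl z≢h₁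
    ...   | yes (there (there z∈p)) with ∈-∃++ z∈p
    ...     | as , bs , refl =
      h₀ , h₁ ∷ as ++ [ z ] , s≤s (∈-length (∈-++⁺ʳ as (here refl))) ,
      Unique-prefix-∷ʳ (h₀ ∷ h₁ ∷ as) uniq ,
      Linked-prefix-∷ʳ (h₀ ∷ h₁ ∷ as) linked (edge-sym h₀z)

    minDeg2⇒empty : ∀ v → A v ≢ true
    minDeg2⇒empty v Av with other-neighbour A v (minDeg2 v Av) v
    ... | w , Aw , vw , w≢v =
      acyclic (extend-path n w v [] ((w≢v ∷ []) ∷ [] ∷ []) (edge-sym vw ∷ [-]) Aw (m<m+n n (s≤s z≤n)))

  edgeEnds-empty : ∀ A → (∀ v → A v ≢ true) → edgeEnds A ≡ 0
  edgeEnds-empty A empty = sum-map-≡0 (allFin n) λ w → sum-map-≡0 (allFin n) λ u → dead w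
    where dead : ∀ w {b} → 𝟙 (A w ∧ b) ≡ 0
          dead w with A w | empty w
          ... | true  | ¬true = contradiction refl ¬true
          ... | false | _     = refl

  size-∖ : ∀ A v → A v ≡ true → size A ≡ suc (size (A ∖ v))
  size-∖ A v Av = begin
    size A                                              ≡⟨ sum-map-cong (allFin n) split ⟩
    ∑ (λ w → (if does (w ≟ v) then 1 else 0) + 𝟙 ((A ∖ v) w)) ≡⟨ sum-map-+ _ _ (allFin n) ⟩
    ∑ (λ w → if does (w ≟ v) then 1 else 0) + size (A ∖ v) ≡⟨ cong (_+ size (A ∖ v)) (∑-indicator v 1) ⟩
    suc (size (A ∖ v))                                  ∎
    where
    open ≡-Reasoning
    split : ∀ w → 𝟙 (A w) ≡ (if does (w ≟ v) then 1 else 0) + 𝟙 ((A ∖ v) w)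
    split w with w ≟ v
    ... | yes refl rewrite Av = refl
    ... | no _     = refl

  incidence-∖ : ∀ A v w u →
    𝟙 (A w ∧ A u ∧ G w u) ≤ 𝟙 ((A ∖ v) w ∧ (A ∖ v) u ∧ G w u)
                            + (if does (w ≟ v) then 𝟙 (A u ∧ G v u) else 0)
                            + (if does (u ≟ v) then 𝟙 (A w ∧ G w v) else 0)
  incidence-∖ A v w u with w ≟ v | u ≟ v
  ... | yes refl | _        = ≤-trans (𝟙-∧-≤ʳ (A v) (A u ∧ G v u)) (m≤m+n (𝟙 (A u ∧ G v u)) _)
  ... | no _     | yes refl = ≤-trans (𝟙-∧-skip (A w) (A v) (G w v)) (m≤n+m _ (𝟙 (A w ∧ false) + 0))
  ... | no _     | no _     = ≤-trans (m≤m+n _ 0) (m≤m+n (𝟙 (A w ∧ A u ∧ G w u) + 0) 0)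

  edgeEnds-∖ : ∀ A v → edgeEnds A ≤ edgeEnds (A ∖ v) + degIn A v + degIn A v
  edgeEnds-∖ A v = begin
    edgeEnds A
      ≤⟨ sum-map-mono (allFin n) (λ w → sum-map-mono (allFin n) (incidence-∖ A v w)) ⟩
    ∑ (λ w → ∑ λ u → kept w u + first w u + second w u)
      ≡⟨ sum-map-cong (allFin n) (λ w → sum-map-+₃ (kept w) (first w) (second w) (allFin n)) ⟩
    ∑ (λ w → ∑ (kept w) + ∑ (first w) + ∑ (second w))
      ≡⟨ sum-map-+₃ (∑ ∘ kept) (∑ ∘ first) (∑ ∘ second) (allFin n) ⟩
    edgeEnds (A ∖ v) + ∑ (∑ ∘ first) + ∑ (∑ ∘ second)
      ≡⟨ cong₂ (λ a b → edgeEnds (A ∖ v) + a + b) ∑∑-first ∑∑-second ⟩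
    edgeEnds (A ∖ v) + degIn A v + degIn A v ∎
    where
    open ≤-Reasoning
    kept first second : Fin n → Fin n → ℕ
    kept   w u = 𝟙 ((A ∖ v) w ∧ (A ∖ v) u ∧ G w u)
    first  w u = if does (w ≟ v) then 𝟙 (A u ∧ G v u) else 0
    second w u = if does (u ≟ v) then 𝟙 (A w ∧ G w v) else 0

    ∑∑-first : ∑ (∑ ∘ first) ≡ degIn A v
    ∑∑-first = trans (sum-map-cong (allFin n) inner) (∑-indicator v (degIn A v))
      where inner : ∀ w → ∑ (first w) ≡ (if does (w ≟ v) then degIn A v else 0)
            inner w with w ≟ v
            ... | yes refl = refl
            ... | no _     = sum-map-≡0 (allFin n) λ _ → refl

    ∑∑-second : ∑ (∑ ∘ second) ≡ degIn A v
    ∑∑-second = sum-map-cong (allFin n) λ w →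
      trans (∑-indicator v (𝟙 (A w ∧ G w v))) (cong (λ b → 𝟙 (A w ∧ b)) (symmetric w v))

  leaf-or-minDeg2 : ∀ A → (∃[ v ] A v ≡ true × degIn A v ≤ 1) ⊎ (∀ v → A v ≡ true → 2 ≤ degIn A v)
  leaf-or-minDeg2 A with any? (λ v → (A v Bool.≟ true) ×-dec (degIn A v ≤? 1)) (allFin n)
  ... | yes leaf  = inj₁ (satisfied leaf)
  ... | no noLeaf = inj₂ λ v Av → ≰⇒> λ deg≤1 → noLeaf (lose (∈-allFin v) (Av , deg≤1))

  edgeEnds-≤ : ∀ k A → size A ≤ k → edgeEnds A ≤ 2 * size A
  edgeEnds-≤ k A size≤k with leaf-or-minDeg2 A
  ... | inj₂ minDeg2 = subst (_≤ 2 * size A) (sym (edgeEnds-empty A (minDeg2⇒empty A minDeg2))) z≤n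
  edgeEnds-≤ zero    A size≤0 | inj₁ (v , Av , _) =
    contradiction (subst (_≤ 0) (size-∖ A v Av) size≤0) λ ()
  edgeEnds-≤ (suc k) A size≤k | inj₁ (v , Av , deg≤1) = begin
    edgeEnds A                                      ≤⟨ edgeEnds-∖ A v ⟩
    edgeEnds (A ∖ v) + degIn A v + degIn A v        ≤⟨ +-mono-≤ (+-mono-≤ ih deg≤1) deg≤1 ⟩
    2 * size (A ∖ v) + 1 + 1                        ≡⟨ +-assoc (2 * size (A ∖ v)) 1 1 ⟩
    2 * size (A ∖ v) + 2                            ≡⟨ +-comm (2 * size (A ∖ v)) 2 ⟩
    2 + 2 * size (A ∖ v)                            ≡⟨ *-suc 2 (size (A ∖ v)) ⟨
    2 * suc (size (A ∖ v))                          ≡⟨ cong (2 *_) (size-∖ A v Av) ⟨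
    2 * size A                                      ∎
    where
    open ≤-Reasoning
    ih : edgeEnds (A ∖ v) ≤ 2 * size (A ∖ v)
    ih = edgeEnds-≤ k (A ∖ v) (s≤s⁻¹ (subst (_≤ suc k) (size-∖ A v Av) size≤k))

  ∑-deg-≤ : ∑ (deg G) ≤ 2 * n
  ∑-deg-≤ = subst (λ k → ∑ (deg G) ≤ 2 * k) (∑-const-1 n)
    (edgeEnds-≤ n (λ _ → true) (≤-reflexive (∑-const-1 n)))

toℚ≡mkℚ : ∀ k → toℚ k ≡ mkℚ (ℤ.+ k) 0 (Coprime.sym (Coprime.1-coprimeTo k))
toℚ≡mkℚ k = ℚₚ.↥p/↧p≡p (mkℚ (ℤ.+ k) 0 _)

toℚ-+ : ∀ a b → toℚ (a + b) ≡ toℚ a ℚ.+ toℚ b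
toℚ-+ a b = trans (ℚₚ./-cong numerator refl) (sym (cong₂ ℚ._+_ (toℚ≡mkℚ a) (toℚ≡mkℚ b)))
  where
  numerator : ℤ.+ (a + b) ≡ (Sign.+ ℤ.◃ (a * 1)) ℤ.+ (Sign.+ ℤ.◃ (b * 1))
  numerator rewrite *-identityʳ a | *-identityʳ b | ℤ.+◃n≡+n a | ℤ.+◃n≡+n b = refl

toℚ-* : ∀ a b → toℚ (a * b) ≡ toℚ a ℚ.* toℚ b
toℚ-* a b = trans (ℚₚ./-cong (sym (ℤ.+◃n≡+n (a * b))) refl) (sym (cong₂ ℚ._*_ (toℚ≡mkℚ a) (toℚ≡mkℚ b)))

toℚ-mono-≤ : ∀ {a b} → a ≤ b → toℚ a ℚ.≤ toℚ b
toℚ-mono-≤ {a} {b} a≤b rewrite toℚ≡mkℚ a | toℚ≡mkℚ b = ℚ.*≤* cross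
  where
  cross : (Sign.+ ℤ.◃ (a * 1)) ℤ.≤ (Sign.+ ℤ.◃ (b * 1))
  cross rewrite *-identityʳ a | *-identityʳ b | ℤ.+◃n≡+n a | ℤ.+◃n≡+n b = ℤ.+≤+ a≤b

toℚ-nonNegative : ∀ k → ℚ.NonNegative (toℚ k)
toℚ-nonNegative k = ℚ.nonNegative (toℚ-mono-≤ {0} {k} z≤n)

sum-map-scaled-≤ : ∀ {A : Set} (R : ℚ) (a b : A → ℕ) xs →
  (∀ x → toℚ (a x) ℚ.* R ℚ.≤ toℚ (b x)) → toℚ (sum (map a xs)) ℚ.* R ℚ.≤ toℚ (sum (map b xs))
sum-map-scaled-≤ R a b []       _      = ℚₚ.≤-reflexive (ℚₚ.*-zeroˡ R)
sum-map-scaled-≤ R a b (x ∷ xs) scaled = begin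
  toℚ (a x + sum (map a xs)) ℚ.* R                    ≡⟨ cong (ℚ._* R) (toℚ-+ (a x) _) ⟩
  (toℚ (a x) ℚ.+ toℚ (sum (map a xs))) ℚ.* R          ≡⟨ ℚₚ.*-distribʳ-+ R (toℚ (a x)) _ ⟩
  toℚ (a x) ℚ.* R ℚ.+ toℚ (sum (map a xs)) ℚ.* R      ≤⟨ ℚₚ.+-mono-≤ (scaled x) scaledSum ⟩
  toℚ (b x) ℚ.+ toℚ (sum (map b xs))                  ≡⟨ toℚ-+ (b x) _ ⟨
  toℚ (b x + sum (map b xs))                          ∎
  where
  open ℚₚ.≤-Reasoning
  scaledSum : toℚ (sum (map a xs)) ℚ.* R ℚ.≤ toℚ (sum (map b xs))
  scaledSum = sum-map-scaled-≤ R a b xs scaled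

1+n*m≤2*m*n : ∀ {m n} → 1 ≤ m → 1 ≤ n → 1 + n * m ≤ 2 * m * n
1+n*m≤2*m*n {m} {n} 1≤m 1≤n = begin
  1 + n * m     ≤⟨ +-monoˡ-≤ (n * m) (*-mono-≤ 1≤n 1≤m) ⟩
  n * m + n * m ≡⟨ double m n ⟩
  2 * m * n     ∎
  where
  open ≤-Reasoning
  double : ∀ m n → n * m + n * m ≡ 2 * m * n
  double = solve-∀

module RootedTrees {n : ℕ} (G : BGraph n) (forest : IsForest G) (s : ℕ) where
  open Partition G s
  open ForestDegrees G forest using (edge-irrefl)

  Branch : Fin n → Fin n → Fin n → Set
  Branch r = Conn (Induced Edge' (_≢ r))

  InBadTreeOf : ℚ → Fin n → Fin n → Set
  InBadTreeOf R r v = IsRoot r × Bad R r × Conn Edge' r v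

  -- A walk from a to x is cut at its last visit to r.
  reachable⇒root⊎avoiding⊎branch : ∀ r {a x} → Conn Edge' a x →
    x ≡ r ⊎ (a ≢ r × Branch r a x) ⊎ ∃[ w ] Edge' r w × Branch r w x
  reachable⇒root⊎avoiding⊎branch r {a} ε with a ≟ r
  ... | yes a≡r = inj₁ a≡r
  ... | no a≢r  = inj₂ (inj₁ (a≢r , ε))
  reachable⇒root⊎avoiding⊎branch r {a} (ab ◅ reach) with reachable⇒root⊎avoiding⊎branch r reach
  ... | inj₁ x≡r                      = inj₁ x≡r
  ... | inj₂ (inj₂ viaBranch)         = inj₂ (inj₂ viaBranch)
  ... | inj₂ (inj₁ (b≢r , avoiding)) with a ≟ r
  ...   | yes refl = inj₂ (inj₂ (_ , ab , avoiding))
  ...   | no a≢r   = inj₂ (inj₁ (a≢r , (a≢r , b≢r , ab) ◅ avoiding))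

  reachable⇒root⊎branch : ∀ {r x} → Conn Edge' r x → x ≡ r ⊎ ∃[ w ] Edge' r w × Branch r w x
  reachable⇒root⊎branch {r} reach with reachable⇒root⊎avoiding⊎branch r reach
  ... | inj₁ x≡r                = inj₁ x≡r
  ... | inj₂ (inj₁ (r≢r , _))   = contradiction refl r≢r
  ... | inj₂ (inj₂ viaBranch)   = inj₂ viaBranch

  -- The branch at a neighbour of the root contains that neighbour.
  IsRoot⇒1≤s : ∀ {r} → IsRoot r → 1 ≤ s
  IsRoot⇒1≤s ((_ , ([] , _ , refl , _) , ()) , _)
  IsRoot⇒1≤s {r} ((_ , (w ∷ _ , _ , _ , N⇔) , _) , _ , smallBranches) =
    smallBranches w (rw ◅ ε) (λ { refl → edge-irrefl (proj₁ rw) }) [ w ] ([] ∷ []) (ε ∷ [])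
    where rw : Edge' r w
          rw = Equivalence.to (N⇔ w) (here refl)

  rootedTree-atMost : ∀ {r d} → IsRoot r → Degree Edge' r d → AtMost (Conn Edge' r) (1 + d * s)
  rootedTree-atMost {r} (_ , _ , smallBranches) (N , _ , refl , N⇔) =
    AtMost-⊆ classify (AtMost-⊎ (AtMost-≡ r) (AtMost-Any N branch-small))
    where
    neighbour : ∀ {w} → w ∈ N → Edge' r w
    neighbour {w} = Equivalence.to (N⇔ w)
    branch-small : ∀ {w} → w ∈ N → AtMost (Branch r w) s
    branch-small w∈N =
      smallBranches _ (neighbour w∈N ◅ ε) λ { refl → edge-irrefl (proj₁ (neighbour w∈N)) }
    classify : ∀ {x} → Conn Edge' r x → x ≡ r ⊎ Any (λ w → Branch r w x) N
    classify reach with reachable⇒root⊎branch reach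
    ... | inj₁ x≡r               = inj₁ x≡r
    ... | inj₂ (w , rw , branch) = inj₂ (lose (Equivalence.from (N⇔ w) rw) branch)

  badTree-size-≤ : ∀ {R} .{{_ : ℚ.NonNegative R}} r M → Unique M → All (InBadTreeOf R r) M →
    toℚ (length M) ℚ.* R ℚ.≤ toℚ (2 * s * deg G r)
  badTree-size-≤ {R} r [] _ _ =
    ℚₚ.≤-trans (ℚₚ.≤-reflexive (ℚₚ.*-zeroˡ R)) (toℚ-mono-≤ {0} {2 * s * deg G r} z≤n)
  badTree-size-≤ {R} r M@(_ ∷ _) uniq inTree@((isRoot , (d , degree , bad) , _) ∷ _) = begin
    toℚ (length M) ℚ.* R               ≤⟨ ℚₚ.*-monoʳ-≤-nonNeg R (toℚ-mono-≤ size≤) ⟩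
    toℚ (2 * s * d) ℚ.* R              ≡⟨ cong (ℚ._* R) (toℚ-* (2 * s) d) ⟩
    toℚ (2 * s) ℚ.* toℚ d ℚ.* R        ≡⟨ ℚₚ.*-assoc (toℚ (2 * s)) (toℚ d) R ⟩
    toℚ (2 * s) ℚ.* (toℚ d ℚ.* R)      ≤⟨ ℚₚ.*-monoˡ-≤-nonNeg (toℚ (2 * s)) d*R≤deg ⟩
    toℚ (2 * s) ℚ.* toℚ (deg G r)      ≡⟨ toℚ-* (2 * s) (deg G r) ⟨
    toℚ (2 * s * deg G r)              ∎
    where
    open ℚₚ.≤-Reasoning
    instance
      2s-nonNegative : ℚ.NonNegative (toℚ (2 * s))
      2s-nonNegative = toℚ-nonNegative (2 * s)
    1≤d : 1 ≤ d
    1≤d = let (d₀ , degree₀ , s<d₀) = proj₁ isRoot in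
          ≤-trans (s≤s z≤n) (subst (s <_) (HasSize-unique degree₀ degree) s<d₀)
    size≤ : length M ≤ 2 * s * d
    size≤ = ≤-trans (rootedTree-atMost isRoot degree M uniq (All.map (proj₂ ∘ proj₂) inTree))
                    (1+n*m≤2*m*n (IsRoot⇒1≤s isRoot) 1≤d)
    d*R≤deg : toℚ d ℚ.* R ℚ.≤ toℚ (deg G r)
    d*R≤deg = subst (ℚ._≤ toℚ (deg G r))
                    (trans (cong (λ k → R ℚ.* toℚ k) (m≥n⇒m⊔n≡m 1≤d)) (ℚₚ.*-comm R (toℚ d))) bad

lemma3 : (n s : ℕ) (G : BGraph n) → IsForest G → (R : ℚ) → toℚ s ℚ.< R →
    (L : List (Fin n)) → Unique L → All (Partition.InBadRootedTree G s R) L →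
    toℚ (length L) ℚ.* R ℚ.≤ toℚ (4 * s * n)
lemma3 n s G forest R s<R L uniq inBad = begin
  toℚ (length L) ℚ.* R                          ≡⟨ cong (λ k → toℚ k ℚ.* R) (∑-length-fibre L inBad) ⟨
  toℚ (∑ λ r → length (fibre r L inBad)) ℚ.* R  ≤⟨ sum-map-scaled-≤ R _ _ (allFin n) perRoot ⟩
  toℚ (∑ λ r → 2 * s * deg G r)                 ≡⟨ cong toℚ (sum-map-*ˡ (2 * s) (deg G) (allFin n)) ⟩
  toℚ (2 * s * ∑ (deg G))                       ≤⟨ toℚ-mono-≤ (*-monoʳ-≤ (2 * s) ∑-deg-≤) ⟩
  toℚ (2 * s * (2 * n))                         ≡⟨ cong toℚ (reassociate s n) ⟩
  toℚ (4 * s * n)                               ∎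
  where
  open ℚₚ.≤-Reasoning
  open RootedTrees G forest s using (badTree-size-≤)
  open ForestDegrees G forest using (∑-deg-≤)

  instance
    R-nonNegative : ℚ.NonNegative R
    R-nonNegative = ℚ.nonNegative (ℚₚ.≤-trans (toℚ-mono-≤ {0} {s} z≤n) (ℚₚ.<⇒≤ s<R))

  perRoot : ∀ r → toℚ (length (fibre r L inBad)) ℚ.* R ℚ.≤ toℚ (2 * s * deg G r)
  perRoot r = badTree-size-≤ r (fibre r L inBad) (fibre-unique r inBad uniq) (fibre-all r L inBad)

  reassociate : ∀ s n → 2 * s * (2 * n) ≡ 4 * s * n
  reassociate = solve-∀
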